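{- Let $k\ge 0$, let $C_k$ be the chain $x_0<x_1<\dots<x_k$, and let $S=\{y\}$ be the one-element lattice. Then the elements $w$ of the free product $C_k\ast S$ with $w\le y$ are exactly $y$ and the elements $y\wedge x_i$ for $0\le i\le k$.
   Context: The free product $A\ast B$ of lattices $A$ and $B$ is the lattice generated by the disjoint union of $A$ and $B$, subject only to the relations holding in $A$ and in $B$; it is the coproduct in the category of lattices. -}

module Defs where

open import Level using (0ℓ)
open import Data.Nat using (ℕ; suc; _≤ᵇ_)
open import Data.Fin using (Fin; toℕ)
open import Data.Unit using (⊤; tt)
open import Data.Bool using (if_then_else_)
open import Relation.Binary.PropositionalEquality using (_≡_)
open import Algebra.Lattice.Bundles.Raw using (RawLattice)

data Term (G : Set) : Set where
  gen  : G → Term G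
  _∨ₜ_ : Term G → Term G → Term G
  _∧ₜ_ : Term G → Term G → Term G

infixr 6 _∨ₜ_
infixr 7 _∧ₜ_

-- Free product A ∗ B of (the lattices underlying) A and B:
-- the lattice presented by generators  A ⊎ B  (disjoint union),
-- subject to the lattice axioms and to the relations holding in A and in B.
-- Its elements are terms; its equality is the least lattice congruence
-- containing those relations (no quotient types in Agda, so we use a setoid).
module FreeProduct (A B : RawLattice 0ℓ 0ℓ) where
  private
    module A = RawLattice A
    module B = RawLattice B

  data Gen : Set where
    inl : A.Carrier → Gen
    inr : B.Carrier → Gen

  T : Set
  T = Term Gen

  infix 4 _≈_
  data _≈_ : T → T → Set where
    ≈-refl  : ∀ {u} → u ≈ u
    ≈-sym   : ∀ {u v} → u ≈ v → v ≈ u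
    ≈-trans : ∀ {u v w} → u ≈ v → v ≈ w → u ≈ w
    ∨-cong  : ∀ {u u' v v'} → u ≈ u' → v ≈ v' → (u ∨ₜ v) ≈ (u' ∨ₜ v')
    ∧-cong  : ∀ {u u' v v'} → u ≈ u' → v ≈ v' → (u ∧ₜ v) ≈ (u' ∧ₜ v')
    ∨-comm  : ∀ u v → (u ∨ₜ v) ≈ (v ∨ₜ u)
    ∧-comm  : ∀ u v → (u ∧ₜ v) ≈ (v ∧ₜ u)
    ∨-assoc : ∀ u v w → ((u ∨ₜ v) ∨ₜ w) ≈ (u ∨ₜ (v ∨ₜ w))
    ∧-assoc : ∀ u v w → ((u ∧ₜ v) ∧ₜ w) ≈ (u ∧ₜ (v ∧ₜ w))
    ∨-absorbs-∧ : ∀ u v → (u ∨ₜ (u ∧ₜ v)) ≈ u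
    ∧-absorbs-∨ : ∀ u v → (u ∧ₜ (u ∨ₜ v)) ≈ u
    A-≈ : ∀ {a a'} → a A.≈ a' → gen (inl a) ≈ gen (inl a')
    A-∨ : ∀ a a' → gen (inl (a A.∨ a')) ≈ (gen (inl a) ∨ₜ gen (inl a'))
    A-∧ : ∀ a a' → gen (inl (a A.∧ a')) ≈ (gen (inl a) ∧ₜ gen (inl a'))
    B-≈ : ∀ {b b'} → b B.≈ b' → gen (inr b) ≈ gen (inr b')
    B-∨ : ∀ b b' → gen (inr (b B.∨ b')) ≈ (gen (inr b) ∨ₜ gen (inr b'))
    B-∧ : ∀ b b' → gen (inr (b B.∧ b')) ≈ (gen (inr b) ∧ₜ gen (inr b'))

  infix 4 _≤_
  _≤_ : T → T → Set
  u ≤ v = (u ∧ₜ v) ≈ u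

-- The chain C_k : x_0 < x_1 < ... < x_k, carrier Fin (suc k), x_i = i.
chainMeet chainJoin : ∀ {n} → Fin n → Fin n → Fin n
chainMeet i j = if toℕ i ≤ᵇ toℕ j then i else j
chainJoin i j = if toℕ i ≤ᵇ toℕ j then j else i

Chain : ℕ → RawLattice 0ℓ 0ℓ
Chain k = record
  { Carrier = Fin (suc k)
  ; _≈_ = _≡_
  ; _∧_ = chainMeet
  ; _∨_ = chainJoin
  }

One : RawLattice 0ℓ 0ℓ
One = record
  { Carrier = ⊤
  ; _≈_ = _≡_
  ; _∧_ = λ _ _ → tt
  ; _∨_ = λ _ _ → tt
  }

{-# OPTIONS --safe #-}
-- Every element w of C ∗ {y}, for a chain C, either lies above y or lies in an
-- interval [y ∧ x, x] for some generator x of C; this is checked by induction on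
-- w, and totality of C lets the larger (for ∨) or smaller (for ∧) of two
-- intervals absorb the other.  If w ≤ y, then in the first case w = y, and in
-- the second case w ≤ x as well, so y ∧ x ≤ w ≤ y ∧ x.
module Submission where

open import Level using (0ℓ)
open import Defs
open import Data.Nat using (ℕ; suc; _≤?_)
open import Data.Nat.Properties using (≤⇒≤ᵇ; ≰⇒≥)
open import Data.Fin using (Fin; toℕ)
open import Data.Unit using (tt)
open import Data.Bool.Properties using (T-≡)
open import Data.Sum using (_⊎_; inj₁; inj₂)
open import Data.Product using (_×_; ∃-syntax; _,_)
open import Relation.Nullary using (yes; no)
open import Function.Bundles using (Equivalence)
open import Relation.Binary.PropositionalEquality using (_≡_; refl)
open import Relation.Binary.Definitions using (Total)
open import Algebra.Lattice.Bundles using (Lattice)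
open import Algebra.Lattice.Bundles.Raw using (RawLattice)
open import Algebra.Lattice.Structures using (IsLattice)
import Algebra.Lattice.Properties.Lattice as LatticeProperties
import Relation.Binary.Lattice as OrderTheoretic
import Relation.Binary.Lattice.Properties.MeetSemilattice as MeetSemilatticeProperties
import Relation.Binary.Construct.NaturalOrder.Left as LeftNaturalOrder

module FreeProductLattice (A B : RawLattice 0ℓ 0ℓ) where
  open FreeProduct A B

  isLattice : IsLattice _≈_ _∨ₜ_ _∧ₜ_
  isLattice = record
    { isEquivalence = record { refl = ≈-refl ; sym = ≈-sym ; trans = ≈-trans }
    ; ∨-comm        = ∨-comm
    ; ∨-assoc       = ∨-assoc
    ; ∨-cong        = ∨-cong
    ; ∧-comm        = ∧-comm
    ; ∧-assoc       = ∧-assoc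
    ; ∧-cong        = ∧-cong
    ; absorptive    = ∨-absorbs-∧ , ∧-absorbs-∨
    }

  lattice : Lattice 0ℓ 0ℓ
  lattice = record { isLattice = isLattice }

  open OrderTheoretic.Lattice (LatticeProperties.∨-∧-orderTheoreticLattice lattice) public
    using (meetSemilattice; x∧y≤x; x∧y≤y; ∧-greatest; x≤x∨y; y≤x∨y; ∨-least; antisym)
    renaming (_≤_ to _⊑_; refl to ⊑-refl; trans to ⊑-trans)
  open MeetSemilatticeProperties meetSemilattice public using (∧-monotonic)

  -- The library's natural order reads u ≈ u ∧ v, the order of the statement (u ∧ v) ≈ u.
  ⊑⇒≤ : ∀ {u v} → u ⊑ v → u ≤ v
  ⊑⇒≤ = ≈-sym

  ≤⇒⊑ : ∀ {u v} → u ≤ v → u ⊑ v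
  ≤⇒⊑ = ≈-sym

module FreeProductWithPoint
  (A : RawLattice 0ℓ 0ℓ)
  (total : Total (LeftNaturalOrder._≤_ (RawLattice._≈_ A) (RawLattice._∧_ A)))
  where
  open RawLattice A using (Carrier) renaming (_∧_ to _∧ᴬ_)
  open LeftNaturalOrder (RawLattice._≈_ A) _∧ᴬ_ using () renaming (_≤_ to _≤ᴬ_)
  open FreeProduct A One
  open FreeProductLattice A One

  y : T
  y = gen (inr tt)

  x : Carrier → T
  x a = gen (inl a)

  x-mono : ∀ {a b} → a ≤ᴬ b → x a ⊑ x b
  x-mono {a} {b} a≈a∧b = ≈-trans (A-≈ a≈a∧b) (A-∧ a b)

  Between : Carrier → T → Set
  Between a w = y ∧ₜ x a ⊑ w × w ⊑ x a

  AboveOrBetween : T → Set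
  AboveOrBetween w = y ⊑ w ⊎ ∃[ a ] Between a w

  y∧x⊑-above : ∀ {a w} → y ⊑ w → y ∧ₜ x a ⊑ w
  y∧x⊑-above y⊑w = ⊑-trans (x∧y≤x _ _) y⊑w

  between-∨ˡ : ∀ {a u v} → Between a u → v ⊑ x a → Between a (u ∨ₜ v)
  between-∨ˡ (lower , upper) v⊑xa = ⊑-trans lower (x≤x∨y _ _) , ∨-least upper v⊑xa

  between-∨ʳ : ∀ {a u v} → u ⊑ x a → Between a v → Between a (u ∨ₜ v)
  between-∨ʳ u⊑xa (lower , upper) = ⊑-trans lower (y≤x∨y _ _) , ∨-least u⊑xa upper

  between-∧ˡ : ∀ {a u v} → Between a u → y ∧ₜ x a ⊑ v → Between a (u ∧ₜ v)
  between-∧ˡ (lower , upper) y∧xa⊑v = ∧-greatest lower y∧xa⊑v , ⊑-trans (x∧y≤x _ _) upper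

  between-∧ʳ : ∀ {a u v} → y ∧ₜ x a ⊑ u → Between a v → Between a (u ∧ₜ v)
  between-∧ʳ y∧xa⊑u (lower , upper) = ∧-greatest y∧xa⊑u lower , ⊑-trans (x∧y≤y _ _) upper

  y∧x-mono : ∀ {a b} → a ≤ᴬ b → y ∧ₜ x a ⊑ y ∧ₜ x b
  y∧x-mono a≤b = ∧-monotonic ⊑-refl (x-mono a≤b)

  between-∨-between : ∀ {a b u v} → Between a u → Between b v → ∃[ c ] Between c (u ∨ₜ v)
  between-∨-between {a} {b} u∈a@(_ , u⊑xa) v∈b@(_ , v⊑xb) with total a b
  ... | inj₁ a≤b = b , between-∨ʳ (⊑-trans u⊑xa (x-mono a≤b)) v∈b
  ... | inj₂ b≤a = a , between-∨ˡ u∈a (⊑-trans v⊑xb (x-mono b≤a))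

  between-∧-between : ∀ {a b u v} → Between a u → Between b v → ∃[ c ] Between c (u ∧ₜ v)
  between-∧-between {a} {b} u∈a@(u-lower , _) v∈b@(v-lower , _) with total a b
  ... | inj₁ a≤b = a , between-∧ˡ u∈a (⊑-trans (y∧x-mono a≤b) v-lower)
  ... | inj₂ b≤a = b , between-∧ʳ (⊑-trans (y∧x-mono b≤a) u-lower) v∈b

  aboveOrBetween : ∀ w → AboveOrBetween w
  aboveOrBetween (gen (inl a)) = inj₂ (a , x∧y≤y _ _ , ⊑-refl)
  aboveOrBetween (gen (inr tt)) = inj₁ ⊑-refl
  aboveOrBetween (u ∨ₜ v) with aboveOrBetween u | aboveOrBetween v
  ... | inj₁ y⊑u       | _              = inj₁ (⊑-trans y⊑u (x≤x∨y _ _))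
  ... | inj₂ _         | inj₁ y⊑v       = inj₁ (⊑-trans y⊑v (y≤x∨y _ _))
  ... | inj₂ (_ , u∈a) | inj₂ (_ , v∈b) = inj₂ (between-∨-between u∈a v∈b)
  aboveOrBetween (u ∧ₜ v) with aboveOrBetween u | aboveOrBetween v
  ... | inj₁ y⊑u       | inj₁ y⊑v       = inj₁ (∧-greatest y⊑u y⊑v)
  ... | inj₁ y⊑u       | inj₂ (b , v∈b) = inj₂ (b , between-∧ʳ (y∧x⊑-above y⊑u) v∈b)
  ... | inj₂ (a , u∈a) | inj₁ y⊑v       = inj₂ (a , between-∧ˡ u∈a (y∧x⊑-above y⊑v))
  ... | inj₂ (_ , u∈a) | inj₂ (_ , v∈b) = inj₂ (between-∧-between u∈a v∈b)

  ⊑y⇒≈y⊎≈y∧x : ∀ w → w ⊑ y → w ≈ y ⊎ ∃[ a ] w ≈ y ∧ₜ x a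
  ⊑y⇒≈y⊎≈y∧x w w⊑y with aboveOrBetween w
  ... | inj₁ y⊑w                = inj₁ (antisym w⊑y y⊑w)
  ... | inj₂ (a , lower , upper) = inj₂ (a , antisym (∧-greatest w⊑y upper) lower)

chainMeet-total : ∀ {k} → Total (LeftNaturalOrder._≤_ _≡_ (chainMeet {suc k}))
chainMeet-total i j with toℕ i ≤? toℕ j
... | yes i≤j rewrite Equivalence.to T-≡ (≤⇒≤ᵇ i≤j)         = inj₁ refl
... | no  i≰j rewrite Equivalence.to T-≡ (≤⇒≤ᵇ (≰⇒≥ i≰j)) = inj₂ refl

lemma3 : (k : ℕ) →
    let open FreeProduct (Chain k) One
        y = gen (inr tt)
        x = λ (i : Fin (suc k)) → gen (inl i)
    in (∀ (w : T) → w ≤ y → (w ≈ y ⊎ ∃[ i ] (w ≈ (y ∧ₜ x i))))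
       × (y ≤ y)
       × (∀ (i : Fin (suc k)) → (y ∧ₜ x i) ≤ y)
lemma3 k =
    (λ w w≤y → ⊑y⇒≈y⊎≈y∧x w (≤⇒⊑ w≤y))
  , ⊑⇒≤ ⊑-refl
  , λ i → ⊑⇒≤ (x∧y≤x _ _)
  where
  open FreeProductLattice (Chain k) One
  open FreeProductWithPoint (Chain k) chainMeet-total
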